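{- Let $L$ be a strongly regular locale and $k:L\to kL$ a compactification of $L$. Let $B_{kL}$ be a basis of $kL$ that is a sub-pcd-lattice of $kL$, let $P_k=\{k^-(b):b\in B_{kL}\}^*\subseteq L$, and let $\lhd_k$ be the least relation on $P_k$ containing $\{(k^-(b),k^-(a)):a,b\in B_{kL},\ b\prec a\}$ and closed under conditions (1)–(5) below. Let $\mathcal C_k$ be the class of continuous maps $f:L\to L'$ with $L'$ compact and regular such that whenever $y\prec x$ in $L'$ there are $p,p'\in P_k$ with $f^-[y]\le p\lhd_k p'\le f^-[x]$. Then for every $f:L\to L'$ in $\mathcal C_k$ there is a unique continuous $g:kL\to L'$ with $g\circ k=f$; and $k$ is the minimal compactification with this property: if $k':L\to k'L$ is a compactification such that every $f\in\mathcal C_k$ factors uniquely as $g\circ k'$, then $k\le k'$.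
   Context: Framework: constructive set theory CZF + RRS-$\bigcup$REA (intuitionistic logic, no Powerset, Restricted Separation only). A locale $(L,B)$ is a pair of classes $(L,\le)$ with finite meets, joins of all subsets, infinite distributivity $x\wedge\bigvee U=\bigvee_{y\in U}(x\wedge y)$, and a set basis $B\subseteq L$ such that $\{b\in B:b\le x\}$ is a set with join $x$ for every $x$. $y^*=\bigvee\{c\in B:c\wedge y=0\}$; $y\prec x$ iff $1=x\vee y^*$. Regular: $a=\bigvee\{b\in B:b\prec a\}$ for $a\in B$; compact: every subset of $B$ with join $1$ has a finite subset with join $1$. A continuous map $f:L\to M$ is a function $f^-:B_M\to L$ preserving the top ($\bigvee_{a\in B_M}f^-(a)=1$), binary meets in the form $f^-(a)\wedge f^-(b)=\bigvee\{f^-(c):c\in B_M,c\le a,c\le b\}$, and covers ($a\le\bigvee U\Rightarrow f^-(a)\le\bigvee_{b\in U}f^-(b)$); $f^-[a]=\bigvee\{f^-(b):b\in B_M,b\le a\}$; $(f\circ g)^-(a)=g^-[f^-(a)]$. Dense: $f^-[a]=0\Rightarrow a=0$; embedding: $f^-[\cdot]$ onto. A compactification of $L$ is a dense embedding into a compact regular locale. For compactifications $k,k'$, $k\le k'$ iff $k=h\circ k'$ for some continuous $h:k'L\to kL$. A relation is interpolative if $R(x,y)$ implies $R(x,z),R(z,y)$ for some $z$; $\prec_0$ is the union of all interpolative set-relations contained in $\prec$; $L$ is strongly regular if there is $si:B\to\mathcal P(B)$ with $a=\bigvee si(a)$ and $b\prec_0a$ for $b\in si(a)$. For a subset $S$ of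 a locale, $S^*$ is the least subset containing $S$ closed under $^*$ and finite meets and joins; a sub-pcd-lattice is a set closed under these operations. Conditions (1)–(5) for a relation $\lhd$: (1) $0\lhd0$, $1\lhd1$; (2) $x\le a\lhd b\le y\Rightarrow x\lhd y$; (3) $x\lhd a,x\lhd b\Rightarrow x\lhd a\wedge b$; (4) $x\lhd a,y\lhd a\Rightarrow x\vee y\lhd a$; (5) $a\lhd b\Rightarrow b^*\lhd a^*$. -}

module Defs where

open import Level using (Level; _⊔_; Lift; lift; lower) renaming (suc to lsuc)
open import Data.Product using (Σ; _×_; _,_; proj₁; proj₂)
open import Data.Bool using (Bool; true; false)
open import Data.Empty using (⊥; ⊥-elim)
open import Data.Nat using (ℕ)
open import Data.Fin using (Fin)

-- Equality of elements is x ≈ y := x ≤ y × y ≤ x (the order is a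
-- partial order up to ≈).  "Sets" are types in Set ℓ, the carrier
-- (a class) lives in Set a.  A subset is a family indexed by Set ℓ.

record Locale (a ℓ : Level) : Set (lsuc (a ⊔ ℓ)) where
  infix 4 _≤_ _≈_
  infixr 7 _∧_
  field
    Carrier : Set a
    _≤_     : Carrier → Carrier → Set ℓ
    ≤-refl  : ∀ {x} → x ≤ x
    ≤-trans : ∀ {x y z} → x ≤ y → y ≤ z → x ≤ z

  _≈_ : Carrier → Carrier → Set ℓ
  x ≈ y = (x ≤ y) × (y ≤ x)

  field
    ⊤       : Carrier
    ⊤-max   : ∀ x → x ≤ ⊤
    _∧_     : Carrier → Carrier → Carrier
    ∧-lb₁   : ∀ x y → x ∧ y ≤ x
    ∧-lb₂   : ∀ x y → x ∧ y ≤ y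
    ∧-glb   : ∀ {x y z} → z ≤ x → z ≤ y → z ≤ x ∧ y
    ⋁       : {I : Set ℓ} → (I → Carrier) → Carrier
    ⋁-ub    : ∀ {I : Set ℓ} (U : I → Carrier) (i : I) → U i ≤ ⋁ U
    ⋁-lub   : ∀ {I : Set ℓ} (U : I → Carrier) (x : Carrier) →
              (∀ i → U i ≤ x) → ⋁ U ≤ x
    distrib : ∀ (x : Carrier) {I : Set ℓ} (U : I → Carrier) →
              x ∧ ⋁ U ≈ ⋁ (λ i → x ∧ U i)
    B       : Set ℓ
    β       : B → Carrier
    basis   : ∀ x → x ≈ ⋁ {Σ B (λ b → β b ≤ x)} (λ p → β (proj₁ p))

  𝟘 : Carrier
  𝟘 = ⋁ {Lift ℓ ⊥} (λ e → ⊥-elim (lower e))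

  infixr 6 _∨_
  _∨_ : Carrier → Carrier → Carrier
  x ∨ y = ⋁ {Lift ℓ Bool} (λ { (lift true) → x ; (lift false) → y })

  _* : Carrier → Carrier
  y * = ⋁ {Σ B (λ c → β c ∧ y ≈ 𝟘)} (λ p → β (proj₁ p))

  infix 4 _≺_
  _≺_ : Carrier → Carrier → Set ℓ
  y ≺ x = ⊤ ≈ x ∨ (y *)

  ⋁Fin : {n : ℕ} → (Fin n → Carrier) → Carrier
  ⋁Fin {n} U = ⋁ {Lift ℓ (Fin n)} (λ i → U (lower i))


module _ {a ℓ : Level} (L : Locale a ℓ) where
  open Locale L

  Regular : Set ℓ
  Regular = ∀ (x : B) → β x ≈ ⋁ {Σ B (λ b → β b ≺ β x)} (λ p → β (proj₁ p))

  Compact : Set (lsuc ℓ)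
  Compact = ∀ {I : Set ℓ} (U : I → B) → ⋁ (λ i → β (U i)) ≈ ⊤ →
            Σ ℕ (λ n → Σ (Fin n → I) (λ s → ⋁Fin (λ j → β (U (s j))) ≈ ⊤))

  InterpolativeIn≺ : {I : Set ℓ} → (I → Carrier × Carrier) → Set ℓ
  InterpolativeIn≺ {I} R =
    (∀ i → proj₁ (R i) ≺ proj₂ (R i)) ×
    (∀ i → Σ I (λ j → Σ I (λ k →
       (proj₁ (R j) ≈ proj₁ (R i)) × (proj₂ (R j) ≈ proj₁ (R k)) ×
       (proj₂ (R k) ≈ proj₂ (R i)))))

  _≺₀_ : Carrier → Carrier → Set (a ⊔ lsuc ℓ)
  x ≺₀ y = Σ (Set ℓ) (λ I → Σ (I → Carrier × Carrier) (λ R →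
             InterpolativeIn≺ R × Σ I (λ i → (proj₁ (R i) ≈ x) × (proj₂ (R i) ≈ y))))

  StronglyRegular : Set (a ⊔ lsuc ℓ)
  StronglyRegular =
    Σ (B → Σ (Set ℓ) (λ J → J → B)) (λ si →
      ∀ (x : B) → (β x ≈ ⋁ (λ j → β (proj₂ (si x) j))) ×
                  (∀ j → β (proj₂ (si x) j) ≺₀ β x))

  SubPcdBasis : Set ℓ
  SubPcdBasis =
    (∀ b → Σ B (λ c → β c ≈ (β b) *)) ×
    Σ B (λ c → β c ≈ ⊤) ×
    (∀ b b' → Σ B (λ c → β c ≈ β b ∧ β b')) ×
    Σ B (λ c → β c ≈ 𝟘) ×
    (∀ b b' → Σ B (λ c → β c ≈ β b ∨ β b'))

open Locale using (Carrier; _≤_; _≈_; ⊤; _∧_; ⋁; B; β; 𝟘; _∨_; _*; _≺_)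

-- Continuous maps f : L → M, given by f⁻ : B_M → L

record Cont {a ℓ : Level} (L M : Locale a ℓ) : Set (a ⊔ lsuc ℓ) where
  field
    f⁻    : B M → Carrier L
    top   : _≈_ L (⋁ L {B M} f⁻) (⊤ L)
    meet  : ∀ (x y : B M) →
            _≈_ L (_∧_ L (f⁻ x) (f⁻ y))
                  (⋁ L {Σ (B M) (λ c → (_≤_ M (β M c) (β M x)) × (_≤_ M (β M c) (β M y)))}
                       (λ p → f⁻ (proj₁ p)))
    cover : ∀ (x : B M) {I : Set ℓ} (U : I → B M) →
            _≤_ M (β M x) (⋁ M (λ i → β M (U i))) →
            _≤_ L (f⁻ x) (⋁ L (λ i → f⁻ (U i)))
open Cont using (f⁻)

module _ {a ℓ : Level} {L M : Locale a ℓ} where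
  _⁻[_] : Cont L M → Carrier M → Carrier L
  f ⁻[ x ] = ⋁ L {Σ (B M) (λ b → _≤_ M (β M b) x)} (λ p → f⁻ f (proj₁ p))

  Dense : Cont L M → Set (a ⊔ ℓ)
  Dense f = ∀ (x : Carrier M) → _≈_ L (f ⁻[ x ]) (𝟘 L) → _≈_ M x (𝟘 M)

  Embedding : Cont L M → Set (a ⊔ ℓ)
  Embedding f = ∀ (y : Carrier L) → Σ (Carrier M) (λ x → _≈_ L (f ⁻[ x ]) y)

  IsCompactification : Cont L M → Set (a ⊔ lsuc ℓ)
  IsCompactification f = Dense f × Embedding f × Compact M × Regular M

-- (g ∘ f)⁻(x) = f⁻[ g⁻(x) ]   (only the inverse-image function is needed)
_∘⁻_ : ∀ {a ℓ} {L M N : Locale a ℓ} → Cont M N → Cont L M → B N → Carrier L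
(g ∘⁻ f) x = f ⁻[ f⁻ g x ]

_∘_≡c_ : ∀ {a ℓ} {L M N : Locale a ℓ} → Cont M N → Cont L M → Cont L N → Set ℓ
_∘_≡c_ {L = L} {N = N} g f h = ∀ (x : B N) → _≈_ L ((g ∘⁻ f) x) (f⁻ h x)

_≡c_ : ∀ {a ℓ} {L M : Locale a ℓ} → Cont L M → Cont L M → Set ℓ
_≡c_ {L = L} {M = M} f g = ∀ (x : B M) → _≈_ L (f⁻ f x) (f⁻ g x)

module _ {a ℓ : Level} {L kL : Locale a ℓ} (k : Cont L kL) where

  -- codes for the elements of P_k = { k⁻(b) : b ∈ B_kL }^*
  data PCode : Set ℓ where
    gen       : B kL → PCode
    star      : PCode → PCode
    top bot   : PCode
    meet join : PCode → PCode → PCode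

  ⟦_⟧ : PCode → Carrier L
  ⟦ gen b ⟧    = f⁻ k b
  ⟦ star p ⟧   = _* L ⟦ p ⟧
  ⟦ top ⟧      = ⊤ L
  ⟦ bot ⟧      = 𝟘 L
  ⟦ meet p q ⟧ = _∧_ L ⟦ p ⟧ ⟦ q ⟧
  ⟦ join p q ⟧ = _∨_ L ⟦ p ⟧ ⟦ q ⟧

  data _⊲_ : PCode → PCode → Set ℓ where
    gen⊲ : ∀ (x y : B kL) → _≺_ kL (β kL y) (β kL x) → gen y ⊲ gen x
    c1₀  : bot ⊲ bot
    c1₁  : top ⊲ top
    c2   : ∀ {x p q y} → _≤_ L ⟦ x ⟧ ⟦ p ⟧ → p ⊲ q → _≤_ L ⟦ q ⟧ ⟦ y ⟧ → x ⊲ y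
    c3   : ∀ {x p q} → x ⊲ p → x ⊲ q → x ⊲ meet p q
    c4   : ∀ {x y p} → x ⊲ p → y ⊲ p → join x y ⊲ p
    c5   : ∀ {p q} → p ⊲ q → star q ⊲ star p

  InC : (L' : Locale a ℓ) → Cont L L' → Set (a ⊔ lsuc ℓ)
  InC L' f = Compact L' × Regular L' ×
    (∀ (x y : Carrier L') → _≺_ L' y x →
       Σ PCode (λ p → Σ PCode (λ p' →
         (_≤_ L (f ⁻[ y ]) ⟦ p ⟧) × (p ⊲ p') × (_≤_ L ⟦ p' ⟧ (f ⁻[ x ])))))

UniqueFactor : ∀ {a ℓ} {L cL L' : Locale a ℓ} → Cont L cL → Cont L L' → Set (a ⊔ lsuc ℓ)
UniqueFactor {cL = cL} {L' = L'} c f =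
  Σ (Cont cL L') (λ g → (g ∘ c ≡c f) × (∀ (g' : Cont cL L') → g' ∘ c ≡c f → g' ≡c g))

{-# OPTIONS --safe #-}
module Submission where

open import Defs
open import Level using (Level; Lift; lift; lower)
open import Data.Product using (Σ; _×_; _,_; proj₁; proj₂)
open import Data.Sum using (_⊎_; inj₁; inj₂; [_,_]′)
open import Data.Bool using (true; false)
open import Data.Unit using (tt) renaming (⊤ to Unit)
open import Data.Nat using (ℕ; zero; suc)
open import Data.Fin using (Fin; zero; suc)
open import Function using (_∘′_)
open import Relation.Binary.Bundles using (Preorder)
open import Relation.Binary.PropositionalEquality using (_≡_; refl; cong; isEquivalence)
import Relation.Binary.Reasoning.Preorder as PreorderReasoning

-- Write k₊ for the right adjoint of k⁻[_].  An f in C_k extends along k by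
-- g⁻(x) = ⋁ { k₊ f⁻[e] : e ≺ x }.  The crux is that p ⊲_k q forces
-- k₊(p*) ∨ k₊ q = 1; this invariant survives the closure rules (1)–(5) and finite
-- joins, so compactness and regularity of L′ turn every cover into a finite one
-- made of ⊲_k-pairs, and g⁻ preserves covers.  Density of k gives uniqueness.
-- Minimality holds because k itself lies in C_k: by compactness of kL a
-- relation y ≺ x is covered by finitely many basic pairs b′ ≺ b ≤ x, which are
-- generators of ⊲_k.

module LocaleProperties {a ℓ : Level} (L : Locale a ℓ) where
  open Locale L public

  ≤-preorder : Preorder a a ℓ
  ≤-preorder = record
    { _≈_ = _≡_
    ; _≲_ = _≤_
    ; isPreorder = record
      { isEquivalence = isEquivalence
      ; reflexive = λ { refl → ≤-refl }
      ; trans = ≤-trans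
      }
    }

  module ≤-Reasoning = PreorderReasoning ≤-preorder

  x≤x∨y : ∀ {x y} → x ≤ x ∨ y
  x≤x∨y = ⋁-ub _ (lift true)

  y≤x∨y : ∀ {x y} → y ≤ x ∨ y
  y≤x∨y = ⋁-ub _ (lift false)

  ∨-least : ∀ {x y z} → x ≤ z → y ≤ z → x ∨ y ≤ z
  ∨-least {z = z} x≤z y≤z = ⋁-lub _ z λ { (lift true) → x≤z ; (lift false) → y≤z }

  ∨-mono : ∀ {x y x′ y′} → x ≤ x′ → y ≤ y′ → x ∨ y ≤ x′ ∨ y′
  ∨-mono x≤x′ y≤y′ = ∨-least (≤-trans x≤x′ x≤x∨y) (≤-trans y≤y′ y≤x∨y)

  ∨-comm : ∀ {x y} → x ∨ y ≤ y ∨ x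
  ∨-comm = ∨-least y≤x∨y x≤x∨y

  𝟘-least : ∀ {x} → 𝟘 ≤ x
  𝟘-least {x} = ⋁-lub _ x λ { (lift ()) }

  ∧-comm : ∀ {x y} → x ∧ y ≤ y ∧ x
  ∧-comm {x} {y} = ∧-glb (∧-lb₂ x y) (∧-lb₁ x y)

  ∧-mono : ∀ {x y x′ y′} → x ≤ x′ → y ≤ y′ → x ∧ y ≤ x′ ∧ y′
  ∧-mono {x} {y} x≤x′ y≤y′ = ∧-glb (≤-trans (∧-lb₁ x y) x≤x′) (≤-trans (∧-lb₂ x y) y≤y′)

  x≤x∧⊤ : ∀ {x} → x ≤ x ∧ ⊤
  x≤x∧⊤ {x} = ∧-glb ≤-refl (⊤-max x)

  ∧-distribˡ-⋁ : ∀ x {I : Set ℓ} (U : I → Carrier) → x ∧ ⋁ U ≤ ⋁ (λ i → x ∧ U i)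
  ∧-distribˡ-⋁ x U = proj₁ (distrib x U)

  ∧-distribˡ-∨-least : ∀ {x y y′ z} → x ∧ y ≤ z → x ∧ y′ ≤ z → x ∧ (y ∨ y′) ≤ z
  ∧-distribˡ-∨-least {x} {z = z} x∧y≤z x∧y′≤z =
    ≤-trans (∧-distribˡ-⋁ x _) (⋁-lub _ z λ { (lift true) → x∧y≤z ; (lift false) → x∧y′≤z })

  ∧-distribʳ-∨-least : ∀ {x x′ y z} → x ∧ y ≤ z → x′ ∧ y ≤ z → (x ∨ x′) ∧ y ≤ z
  ∧-distribʳ-∨-least x∧y≤z x′∧y≤z =
    ≤-trans ∧-comm (∧-distribˡ-∨-least (≤-trans ∧-comm x∧y≤z) (≤-trans ∧-comm x′∧y≤z))

  ∨∧∨-least : ∀ {x x′ y y′ z} → x ∧ y ≤ z → x ∧ y′ ≤ z → x′ ∧ y ≤ z → x′ ∧ y′ ≤ z →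
              (x ∨ x′) ∧ (y ∨ y′) ≤ z
  ∨∧∨-least xy xy′ x′y x′y′ =
    ∧-distribˡ-∨-least (∧-distribʳ-∨-least xy x′y) (∧-distribʳ-∨-least xy′ x′y′)

  ⋁∧⋁-least : ∀ {I J : Set ℓ} (U : I → Carrier) (V : J → Carrier) {z} →
              (∀ i j → U i ∧ V j ≤ z) → ⋁ U ∧ ⋁ V ≤ z
  ⋁∧⋁-least U V {z} UV≤z = ≤-trans (∧-distribˡ-⋁ (⋁ U) V) (⋁-lub _ z λ j →
    ≤-trans ∧-comm (≤-trans (∧-distribˡ-⋁ (V j) U) (⋁-lub _ z λ i → ≤-trans ∧-comm (UV≤z i j))))

  ⋁-mono : ∀ {I J : Set ℓ} (U : I → Carrier) (V : J → Carrier) →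
           (∀ i → Σ J (λ j → U i ≤ V j)) → ⋁ U ≤ ⋁ V
  ⋁-mono U V below = ⋁-lub U (⋁ V) λ i → ≤-trans (proj₂ (below i)) (⋁-ub V (proj₁ (below i)))

  cover-split : ∀ {I : Set ℓ} {U : I → Carrier} {x} → ⊤ ≤ ⋁ U → x ≤ ⋁ (λ i → x ∧ U i)
  cover-split {U = U} {x} ⊤≤⋁U = ≤-trans x≤x∧⊤ (≤-trans (∧-mono ≤-refl ⊤≤⋁U) (∧-distribˡ-⋁ x U))

  cover-least : ∀ {I : Set ℓ} {U : I → Carrier} {x z} → ⊤ ≤ ⋁ U → (∀ i → x ∧ U i ≤ z) → x ≤ z
  cover-least ⊤≤⋁U pieces = ≤-trans (cover-split ⊤≤⋁U) (⋁-lub _ _ pieces)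

  ⊤≤⋁β : ⊤ ≤ ⋁ β
  ⊤≤⋁β = ≤-trans (proj₁ (basis ⊤)) (⋁-mono _ β λ p → proj₁ p , ≤-refl)

  ∧≤⋁common : ∀ {x y} → x ∧ y ≤ ⋁ {Σ B (λ c → (β c ≤ x) × (β c ≤ y))} (λ c → β (proj₁ c))
  ∧≤⋁common {x} {y} = ≤-trans (proj₁ (basis (x ∧ y))) (⋁-mono _ _ λ c →
    (proj₁ c , ≤-trans (proj₂ c) (∧-lb₁ x y) , ≤-trans (proj₂ c) (∧-lb₂ x y)) , ≤-refl)

  x∧x*≤𝟘 : ∀ {x} → x ∧ x * ≤ 𝟘
  x∧x*≤𝟘 {x} = ≤-trans (∧-distribˡ-⋁ x _) (⋁-lub _ 𝟘 λ c → ≤-trans ∧-comm (proj₁ (proj₂ c)))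

  ∧≤𝟘⇒≤* : ∀ {x y} → x ∧ y ≤ 𝟘 → x ≤ y *
  ∧≤𝟘⇒≤* {x} {y} x∧y≤𝟘 = ≤-trans (proj₁ (basis x)) (⋁-mono _ _ λ b →
    (proj₁ b , ≤-trans (∧-mono (proj₂ b) ≤-refl) x∧y≤𝟘 , 𝟘-least) , ≤-refl)

  *-anti : ∀ {x y} → x ≤ y → y * ≤ x *
  *-anti x≤y = ∧≤𝟘⇒≤* (≤-trans ∧-comm (≤-trans (∧-mono x≤y ≤-refl) x∧x*≤𝟘))

  x≤x** : ∀ {x} → x ≤ (x *) *
  x≤x** = ∧≤𝟘⇒≤* x∧x*≤𝟘

  x*∧y*≤[x∨y]* : ∀ {x y} → x * ∧ y * ≤ (x ∨ y) *
  x*∧y*≤[x∨y]* {x} {y} = ∧≤𝟘⇒≤* (∧-distribˡ-∨-least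
    (≤-trans (∧-mono (∧-lb₁ _ _) ≤-refl) (≤-trans ∧-comm x∧x*≤𝟘))
    (≤-trans (∧-mono (∧-lb₂ _ _) ≤-refl) (≤-trans ∧-comm x∧x*≤𝟘)))

  ⊤≤𝟘* : ⊤ ≤ 𝟘 *
  ⊤≤𝟘* = ∧≤𝟘⇒≤* (∧-lb₂ _ _)

  ≺⇒≤ : ∀ {x y} → y ≺ x → y ≤ x
  ≺⇒≤ {x} {y} y≺x = ≤-trans x≤x∧⊤ (≤-trans (∧-mono ≤-refl (proj₁ y≺x))
    (∧-distribˡ-∨-least (∧-lb₂ y x) (≤-trans x∧x*≤𝟘 𝟘-least)))

  ≺-monoʳ : ∀ {x x′ y} → y ≺ x → x ≤ x′ → y ≺ x′
  ≺-monoʳ y≺x x≤x′ = ≤-trans (proj₁ y≺x) (∨-mono x≤x′ ≤-refl) , ⊤-max _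

  ⊤≺⊤ : ⊤ ≺ ⊤
  ⊤≺⊤ = x≤x∨y , ⊤-max _

  ≺-∧ : ∀ {x x′ y y′} → y ≺ x → y′ ≺ x′ → y ∧ y′ ≺ x ∧ x′
  ≺-∧ y≺x y′≺x′ = ≤-trans (∧-glb (proj₁ y≺x) (proj₁ y′≺x′)) (∨∧∨-least
    x≤x∨y
    (≤-trans (∧-lb₂ _ _) (≤-trans (*-anti (∧-lb₂ _ _)) y≤x∨y))
    (≤-trans (∧-lb₁ _ _) (≤-trans (*-anti (∧-lb₁ _ _)) y≤x∨y))
    (≤-trans (∧-lb₁ _ _) (≤-trans (*-anti (∧-lb₁ _ _)) y≤x∨y))) , ⊤-max _

  Annihilator : Carrier → Set ℓ
  Annihilator y = Σ B (λ c → β c ∧ y ≈ 𝟘)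

  annihilator-cover : ∀ {I : Set ℓ} (W : I → B) {y} → y ≺ ⋁ (λ i → β (W i)) →
                      ⊤ ≤ ⋁ {I ⊎ Annihilator y} (λ j → β ([ W , proj₁ ]′ j))
  annihilator-cover W y≺⋁W = ≤-trans (proj₁ y≺⋁W) (∨-least
    (⋁-mono _ _ λ i → inj₁ i , ≤-refl)
    (⋁-mono _ _ λ c → inj₂ c , ≤-refl))

  ⋁ᶠ : ∀ {n} → (Fin n → Carrier) → Carrier
  ⋁ᶠ {zero} U = 𝟘
  ⋁ᶠ {suc n} U = U zero ∨ ⋁ᶠ (λ i → U (suc i))

  ⋁ᶠ-ub : ∀ {n} (U : Fin n → Carrier) i → U i ≤ ⋁ᶠ U
  ⋁ᶠ-ub U zero = x≤x∨y
  ⋁ᶠ-ub U (suc i) = ≤-trans (⋁ᶠ-ub (λ i → U (suc i)) i) y≤x∨y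

  ⋁ᶠ-least : ∀ {n} (U : Fin n → Carrier) {z} → (∀ i → U i ≤ z) → ⋁ᶠ U ≤ z
  ⋁ᶠ-least {zero} U U≤z = 𝟘-least
  ⋁ᶠ-least {suc n} U U≤z = ∨-least (U≤z zero) (⋁ᶠ-least (λ i → U (suc i)) (λ i → U≤z (suc i)))

  ⋁Fin≤⋁ᶠ : ∀ {n} (U : Fin n → Carrier) → ⋁Fin U ≤ ⋁ᶠ U
  ⋁Fin≤⋁ᶠ U = ⋁-lub _ _ λ i → ⋁ᶠ-ub U (lower i)

  WellInside : B → Set ℓ
  WellInside x = Σ B (λ b → β b ≺ β x)

infix 8 _₊[_]
_₊[_] : ∀ {a ℓ} {L M : Locale a ℓ} → Cont L M → Locale.Carrier L → Locale.Carrier M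
_₊[_] {L = L} {M} h u =
  Locale.⋁ M {Σ (Locale.B M) (λ b → Locale._≤_ L (Cont.f⁻ h b) u)} (λ b → Locale.β M (proj₁ b))

module ContinuousProperties {a ℓ : Level} {L M : Locale a ℓ} (h : Cont L M) where
  private
    module L = LocaleProperties L
    module M = LocaleProperties M

  h⁻ : M.B → L.Carrier
  h⁻ = Cont.f⁻ h

  h⁻-mono : ∀ {b c} → M.β b M.≤ M.β c → h⁻ b L.≤ h⁻ c
  h⁻-mono {b} {c} b≤c = L.≤-trans
    (Cont.cover h b {Lift ℓ Unit} (λ _ → c) (M.≤-trans b≤c (M.⋁-ub _ (lift tt))))
    (L.⋁-lub _ _ λ _ → L.≤-refl)

  ⁻[]-mono : ∀ {x y} → x M.≤ y → h ⁻[ x ] L.≤ h ⁻[ y ]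
  ⁻[]-mono x≤y = L.⋁-mono _ _ λ b → (proj₁ b , M.≤-trans (proj₂ b) x≤y) , L.≤-refl

  h⁻≤⁻[] : ∀ {b x} → M.β b M.≤ x → h⁻ b L.≤ h ⁻[ x ]
  h⁻≤⁻[] {b} b≤x = L.⋁-ub (λ c → h⁻ (proj₁ c)) (b , b≤x)

  ⁻[β]≤h⁻ : ∀ b → h ⁻[ M.β b ] L.≤ h⁻ b
  ⁻[β]≤h⁻ b = L.⋁-lub _ _ λ c → h⁻-mono (proj₂ c)

  ⁻[]-⋁ : ∀ {I : Set ℓ} (U : I → M.Carrier) → h ⁻[ M.⋁ U ] L.≤ L.⋁ (λ i → h ⁻[ U i ])
  ⁻[]-⋁ {I} U = L.⋁-lub _ _ λ b → L.≤-trans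
    (Cont.cover h (proj₁ b) {Σ I (λ i → Σ M.B (λ c → M.β c M.≤ U i))} (λ c → proj₁ (proj₂ c))
      (M.≤-trans (proj₂ b) (M.⋁-lub U _ λ i → M.≤-trans (proj₁ (M.basis (U i)))
        (M.⋁-mono _ _ λ c → (i , c) , M.≤-refl))))
    (L.⋁-mono _ _ λ c → proj₁ c , h⁻≤⁻[] (proj₂ (proj₂ c)))

  ⁻[]-𝟘 : ∀ {x} → x M.≤ M.𝟘 → h ⁻[ x ] L.≤ L.𝟘
  ⁻[]-𝟘 x≤𝟘 = L.≤-trans (⁻[]-mono x≤𝟘) (L.≤-trans (⁻[]-⋁ _) (L.⋁-lub _ _ λ { (lift ()) }))

  ⊤≤⁻[⊤] : L.⊤ L.≤ h ⁻[ M.⊤ ]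
  ⊤≤⁻[⊤] = L.≤-trans (proj₂ (Cont.top h)) (L.⋁-lub _ _ λ b → h⁻≤⁻[] (M.⊤-max _))

  ⁻[]-∧ : ∀ {x y} → h ⁻[ x ] L.∧ h ⁻[ y ] L.≤ h ⁻[ x M.∧ y ]
  ⁻[]-∧ = L.⋁∧⋁-least _ _ λ b c → L.≤-trans (proj₁ (Cont.meet h (proj₁ b) (proj₁ c)))
    (L.⋁-lub _ _ λ d → h⁻≤⁻[] (M.∧-glb
      (M.≤-trans (proj₁ (proj₂ d)) (proj₂ b)) (M.≤-trans (proj₂ (proj₂ d)) (proj₂ c))))

  ⁻[]-* : ∀ {y} → h ⁻[ y M.* ] L.≤ (h ⁻[ y ]) L.*
  ⁻[]-* = L.∧≤𝟘⇒≤* (L.≤-trans ⁻[]-∧ (⁻[]-𝟘 (M.≤-trans M.∧-comm M.x∧x*≤𝟘)))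

  ⊤-cover : ∀ {I : Set ℓ} (V : I → M.B) → M.⊤ M.≤ M.⋁ (λ i → M.β (V i)) →
            L.⊤ L.≤ L.⋁ (λ i → h⁻ (V i))
  ⊤-cover V ⊤≤⋁V = L.≤-trans (proj₂ (Cont.top h))
    (L.⋁-lub _ _ λ b → Cont.cover h b V (M.≤-trans (M.⊤-max _) ⊤≤⋁V))

  ⁻[]-finite-split : Compact M → ∀ {I : Set ℓ} (W : I → M.B) {y} → y M.≺ M.⋁ (λ i → M.β (W i)) →
    Σ ℕ λ n → Σ (Fin n → I ⊎ M.Annihilator y) λ s →
      h ⁻[ y ] L.≤ L.⋁ᶠ (λ j → h ⁻[ y M.∧ M.β ([ W , proj₁ ]′ (s j)) ])
  ⁻[]-finite-split compact W y≺⋁W with compact _ (M.⊤-max _ , M.annihilator-cover W y≺⋁W)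
  ... | n , s , ⋁Fin≈⊤ = n , s , L.≤-trans (⁻[]-mono (M.cover-split (proj₂ ⋁Fin≈⊤)))
          (L.≤-trans (⁻[]-⋁ _) (L.⋁Fin≤⋁ᶠ _))

  ⁻[]-annihilator : ∀ {y} (c : M.Annihilator y) → h ⁻[ y M.∧ M.β (proj₁ c) ] L.≤ L.𝟘
  ⁻[]-annihilator c = ⁻[]-𝟘 (M.≤-trans M.∧-comm (proj₁ (proj₂ c)))

  ₊[]-mono : ∀ {u v} → u L.≤ v → h ₊[ u ] M.≤ h ₊[ v ]
  ₊[]-mono u≤v = M.⋁-mono _ _ λ b → (proj₁ b , L.≤-trans (proj₂ b) u≤v) , M.≤-refl

  ⁻[₊[]]≤ : ∀ {u} → h ⁻[ h ₊[ u ] ] L.≤ u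
  ⁻[₊[]]≤ = L.≤-trans (⁻[]-⋁ _) (L.⋁-lub _ _ λ b → L.≤-trans (⁻[β]≤h⁻ (proj₁ b)) (proj₂ b))

  ≤₊[⁻[]] : ∀ {x} → x M.≤ h ₊[ h ⁻[ x ] ]
  ≤₊[⁻[]] {x} = M.≤-trans (proj₁ (M.basis x)) (M.⋁-mono _ _ λ b → (proj₁ b , h⁻≤⁻[] (proj₂ b)) , M.≤-refl)

  ₊[]-∧ : ∀ {u v} → h ₊[ u ] M.∧ h ₊[ v ] M.≤ h ₊[ u L.∧ v ]
  ₊[]-∧ = M.⋁∧⋁-least _ _ λ b c → M.≤-trans M.∧≤⋁common (M.⋁-mono _ _ λ d →
    (proj₁ d , L.∧-glb (L.≤-trans (h⁻-mono (proj₁ (proj₂ d))) (proj₂ b))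
                       (L.≤-trans (h⁻-mono (proj₂ (proj₂ d))) (proj₂ c))) , M.≤-refl)

  ⊤≤₊[⊤] : M.⊤ M.≤ h ₊[ L.⊤ ]
  ⊤≤₊[⊤] = M.≤-trans ≤₊[⁻[]] (₊[]-mono (L.⊤-max _))

  embedding⇒≤⁻[₊[]] : Embedding h → ∀ {u} → u L.≤ h ⁻[ h ₊[ u ] ]
  embedding⇒≤⁻[₊[]] embedding {u} with embedding u
  ... | x , ⁻[x]≈u = L.≤-trans (proj₂ ⁻[x]≈u) (⁻[]-mono (M.≤-trans ≤₊[⁻[]] (₊[]-mono (proj₁ ⁻[x]≈u))))

  dense⇒𝟘 : Dense h → ∀ {x} → h ⁻[ x ] L.≤ L.𝟘 → x M.≤ M.𝟘
  dense⇒𝟘 dense {x} ⁻[x]≤𝟘 = proj₁ (dense x (⁻[x]≤𝟘 , L.𝟘-least))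

  dense⇒₊[]-𝟘 : Dense h → ∀ {u} → u L.≤ L.𝟘 → h ₊[ u ] M.≤ M.𝟘
  dense⇒₊[]-𝟘 dense u≤𝟘 = dense⇒𝟘 dense (L.≤-trans ⁻[₊[]]≤ u≤𝟘)

module Compactification {a ℓ : Level} {L kL : Locale a ℓ} (k : Cont L kL)
                        (isCompactification : IsCompactification k) where
  private
    module L = LocaleProperties L
    module kL = LocaleProperties kL
    module k = ContinuousProperties k
    dense = proj₁ isCompactification
    embedding = proj₁ (proj₂ isCompactification)
    compact = proj₁ (proj₂ (proj₂ isCompactification))
    regular = proj₂ (proj₂ (proj₂ isCompactification))

    ⟦_⟧ₖ : PCode k → L.Carrier
    ⟦ p ⟧ₖ = ⟦_⟧ k p

    _⊲ₖ_ : PCode k → PCode k → Set ℓ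
    p ⊲ₖ q = _⊲_ k p q

  -- A weak form of k₊ u ≺ x which, unlike it, is stable under binary joins.
  infix 4 _⋐_
  _⋐_ : L.Carrier → kL.Carrier → Set ℓ
  u ⋐ x = kL.⊤ kL.≤ x kL.∨ k ₊[ u L.* ]

  ⋐-mono : ∀ {u u′ x x′} → u′ L.≤ u → u ⋐ x → x kL.≤ x′ → u′ ⋐ x′
  ⋐-mono u′≤u u⋐x x≤x′ = kL.≤-trans u⋐x (kL.∨-mono x≤x′ (k.₊[]-mono (L.*-anti u′≤u)))

  𝟘⋐ : ∀ {x} → L.𝟘 ⋐ x
  𝟘⋐ = kL.≤-trans k.⊤≤₊[⊤] (kL.≤-trans (k.₊[]-mono L.⊤≤𝟘*) kL.y≤x∨y)

  ⋐₊[⊤] : ∀ {u} → u ⋐ k ₊[ L.⊤ ]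
  ⋐₊[⊤] = kL.≤-trans k.⊤≤₊[⊤] kL.x≤x∨y

  ⋐-∧ : ∀ {u x y} → u ⋐ x → u ⋐ y → u ⋐ x kL.∧ y
  ⋐-∧ u⋐x u⋐y = kL.≤-trans (kL.∧-glb u⋐x u⋐y) (kL.∨∧∨-least
    kL.x≤x∨y
    (kL.≤-trans (kL.∧-lb₂ _ _) kL.y≤x∨y)
    (kL.≤-trans (kL.∧-lb₁ _ _) kL.y≤x∨y)
    (kL.≤-trans (kL.∧-lb₁ _ _) kL.y≤x∨y))

  ⋐-∨ : ∀ {u v x y} → u ⋐ x → v ⋐ y → u L.∨ v ⋐ x kL.∨ y
  ⋐-∨ u⋐x v⋐y = kL.≤-trans (kL.∧-glb u⋐x v⋐y) (kL.∨∧∨-least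
    (kL.≤-trans (kL.∧-lb₁ _ _) (kL.≤-trans kL.x≤x∨y kL.x≤x∨y))
    (kL.≤-trans (kL.∧-lb₁ _ _) (kL.≤-trans kL.x≤x∨y kL.x≤x∨y))
    (kL.≤-trans (kL.∧-lb₂ _ _) (kL.≤-trans kL.y≤x∨y kL.x≤x∨y))
    (kL.≤-trans k.₊[]-∧ (kL.≤-trans (k.₊[]-mono L.x*∧y*≤[x∨y]*) kL.y≤x∨y)))

  ⋐-swap : ∀ {u v} → u ⋐ k ₊[ v ] → v L.* ⋐ k ₊[ u L.* ]
  ⋐-swap u⋐₊v = kL.≤-trans u⋐₊v (kL.≤-trans kL.∨-comm (kL.∨-mono kL.≤-refl (k.₊[]-mono L.x≤x**)))

  ≺⇒⋐ : ∀ {x y} → kL.β y kL.≺ kL.β x → Cont.f⁻ k y ⋐ k ₊[ Cont.f⁻ k x ]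
  ≺⇒⋐ {x} {y} y≺x = kL.≤-trans (proj₁ y≺x) (kL.∨-mono
    (kL.≤-trans k.≤₊[⁻[]] (k.₊[]-mono (k.⁻[β]≤h⁻ x)))
    (kL.≤-trans k.≤₊[⁻[]] (k.₊[]-mono (L.≤-trans k.⁻[]-* (L.*-anti (k.h⁻≤⁻[] kL.≤-refl))))))

  ⊲⇒⋐ : ∀ {p q} → p ⊲ₖ q → ⟦ p ⟧ₖ ⋐ k ₊[ ⟦ q ⟧ₖ ]
  ⊲⇒⋐ (gen⊲ x y y≺x) = ≺⇒⋐ y≺x
  ⊲⇒⋐ c1₀ = 𝟘⋐
  ⊲⇒⋐ c1₁ = ⋐₊[⊤]
  ⊲⇒⋐ (c2 x≤p p⊲q q≤y) = ⋐-mono x≤p (⊲⇒⋐ p⊲q) (k.₊[]-mono q≤y)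
  ⊲⇒⋐ (c3 x⊲p x⊲q) = ⋐-mono L.≤-refl (⋐-∧ (⊲⇒⋐ x⊲p) (⊲⇒⋐ x⊲q)) k.₊[]-∧
  ⊲⇒⋐ (c4 x⊲p y⊲p) = ⋐-mono L.≤-refl (⋐-∨ (⊲⇒⋐ x⊲p) (⊲⇒⋐ y⊲p)) (kL.∨-least kL.≤-refl kL.≤-refl)
  ⊲⇒⋐ (c5 p⊲q) = ⋐-swap (⊲⇒⋐ p⊲q)

  ⋐-⋁ᶠ : ∀ {n} (u : Fin n → L.Carrier) (x : Fin n → kL.Carrier) →
         (∀ j → u j ⋐ x j) → L.⋁ᶠ u ⋐ kL.⋁ᶠ x
  ⋐-⋁ᶠ {zero} u x u⋐x = 𝟘⋐
  ⋐-⋁ᶠ {suc n} u x u⋐x = ⋐-∨ (u⋐x zero) (⋐-⋁ᶠ (λ j → u (suc j)) (λ j → x (suc j)) (λ j → u⋐x (suc j)))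

  ⋐⇒₊[]≤ : ∀ {u v x} → u L.≤ v → v ⋐ x → k ₊[ u ] kL.≤ x
  ⋐⇒₊[]≤ {u} {v} {x} u≤v v⋐x = kL.cover-least v⋐x λ
    { (lift true) → kL.∧-lb₂ _ _
    ; (lift false) → kL.≤-trans k.₊[]-∧ (kL.≤-trans
        (k.dense⇒₊[]-𝟘 dense (L.≤-trans (L.∧-mono u≤v L.≤-refl) L.x∧x*≤𝟘)) kL.𝟘-least) }

  module Extension {L′ : Locale a ℓ} (f : Cont L L′) (f∈C : InC k L′ f) where
    private
      module L′ = LocaleProperties L′
      module f = ContinuousProperties f
      compact′ = proj₁ f∈C
      regular′ = proj₁ (proj₂ f∈C)
      interpolate = proj₂ (proj₂ f∈C)

    ≺⇒⁻[]⋐ : ∀ {x y} → y L′.≺ x → f ⁻[ y ] ⋐ k ₊[ f ⁻[ x ] ]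
    ≺⇒⁻[]⋐ {x} {y} y≺x with interpolate x y y≺x
    ... | p , p′ , ⁻[y]≤p , p⊲p′ , p′≤⁻[x] = ⋐-mono ⁻[y]≤p (⊲⇒⋐ p⊲p′) (k.₊[]-mono p′≤⁻[x])

    ext⁻ : L′.B → kL.Carrier
    ext⁻ x = kL.⋁ {L′.WellInside x} (λ e → k ₊[ f ⁻[ L′.β (proj₁ e) ] ])

    ext⁻-mono : ∀ {x x′} → L′.β x L′.≤ L′.β x′ → ext⁻ x kL.≤ ext⁻ x′
    ext⁻-mono x≤x′ = kL.⋁-mono _ _ λ e → (proj₁ e , L′.≺-monoʳ (proj₂ e) x≤x′) , kL.≤-refl

    ₊[⁻[]]≤⋁ext⁻ : ∀ {I : Set ℓ} (U : I → L′.B) {y} → y L′.≺ L′.⋁ (λ i → L′.β (U i)) →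
                   k ₊[ f ⁻[ y ] ] kL.≤ kL.⋁ (λ i → ext⁻ (U i))
    ₊[⁻[]]≤⋁ext⁻ {I} U {y} y≺⋁U = kL.≤-trans
      (⋐⇒₊[]≤ (L.≤-trans ⁻[y]≤⋁ᶠ (L.⋁ᶠ-least _ λ j → L.≤-trans (⁻[y∧]≤inner (s j)) (L.⋁ᶠ-ub _ j)))
              (⋐-⋁ᶠ _ _ λ j → inner⋐outer (s j)))
      (kL.⋁ᶠ-least _ λ j → outer≤ (s j))
      where
      -- In a chain d ≺ e ≺ U i, f ∈ C_k separates f⁻[d] from f⁻[e], and k₊ f⁻[e] ≤ ext⁻ (U i).
      Chain : Set ℓ
      Chain = Σ I λ i → Σ (L′.WellInside (U i)) λ e → L′.WellInside (proj₁ e)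
      chain : Chain → L′.B
      chain (_ , _ , d) = proj₁ d
      refine : L′.⋁ (λ i → L′.β (U i)) L′.≤ L′.⋁ (λ c → L′.β (chain c))
      refine = L′.⋁-lub _ _ λ i → L′.≤-trans (proj₁ (regular′ (U i))) (L′.⋁-lub _ _ λ e →
        L′.≤-trans (proj₁ (regular′ (proj₁ e))) (L′.⋁-mono _ _ λ d → (i , e , d) , L′.≤-refl))
      split = f.⁻[]-finite-split compact′ chain (L′.≺-monoʳ y≺⋁U refine)
      s = proj₁ (proj₂ split)
      ⁻[y]≤⋁ᶠ = proj₂ (proj₂ split)
      inner : Chain ⊎ L′.Annihilator y → L.Carrier
      inner (inj₁ (_ , _ , d)) = f ⁻[ L′.β (proj₁ d) ]
      inner (inj₂ _) = L.𝟘
      outer : Chain ⊎ L′.Annihilator y → kL.Carrier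
      outer (inj₁ (_ , e , _)) = k ₊[ f ⁻[ L′.β (proj₁ e) ] ]
      outer (inj₂ _) = kL.𝟘
      inner⋐outer : ∀ j → inner j ⋐ outer j
      inner⋐outer (inj₁ (_ , _ , d)) = ≺⇒⁻[]⋐ (proj₂ d)
      inner⋐outer (inj₂ _) = 𝟘⋐
      ⁻[y∧]≤inner : ∀ j → f ⁻[ y L′.∧ L′.β ([ chain , proj₁ ]′ j) ] L.≤ inner j
      ⁻[y∧]≤inner (inj₁ _) = f.⁻[]-mono (L′.∧-lb₂ _ _)
      ⁻[y∧]≤inner (inj₂ c) = f.⁻[]-annihilator c
      outer≤ : ∀ j → outer j kL.≤ kL.⋁ (λ i → ext⁻ (U i))
      outer≤ (inj₁ (i , e , _)) = kL.≤-trans (kL.⋁-ub _ e) (kL.⋁-ub _ i)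
      outer≤ (inj₂ _) = kL.𝟘-least

    ext : Cont kL L′
    ext = record
      { f⁻ = ext⁻
      ; top = kL.⊤-max _ , kL.≤-trans k.⊤≤₊[⊤] (kL.≤-trans (k.₊[]-mono f.⊤≤⁻[⊤])
                (₊[⁻[]]≤⋁ext⁻ (λ b → b) (L′.≺-monoʳ L′.⊤≺⊤ L′.⊤≤⋁β)))
      ; meet = λ x y →
          kL.⋁∧⋁-least _ _ (λ e e′ → kL.≤-trans k.₊[]-∧ (kL.≤-trans (k.₊[]-mono f.⁻[]-∧)
            (₊[⁻[]]≤⋁ext⁻ proj₁ (L′.≺-monoʳ (L′.≺-∧ (proj₂ e) (proj₂ e′)) L′.∧≤⋁common))))
          , kL.⋁-lub _ _ (λ c → kL.∧-glb (ext⁻-mono (proj₁ (proj₂ c))) (ext⁻-mono (proj₂ (proj₂ c))))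
      ; cover = λ x U x≤⋁U → kL.⋁-lub _ _ λ e → ₊[⁻[]]≤⋁ext⁻ U (L′.≺-monoʳ (proj₂ e) x≤⋁U)
      }

    ext∘k≡f : ext ∘ k ≡c f
    ext∘k≡f x = ⁻[ext⁻]≤ , ≤⁻[ext⁻]
      where
      ⁻[ext⁻]≤ : k ⁻[ ext⁻ x ] L.≤ Cont.f⁻ f x
      ⁻[ext⁻]≤ = L.≤-trans (k.⁻[]-⋁ _) (L.⋁-lub _ _ λ e → L.≤-trans k.⁻[₊[]]≤
        (L.≤-trans (f.⁻[]-mono (L′.≺⇒≤ (proj₂ e))) (f.⁻[β]≤h⁻ x)))
      ≤⁻[ext⁻] : Cont.f⁻ f x L.≤ k ⁻[ ext⁻ x ]
      ≤⁻[ext⁻] = L.≤-trans (Cont.cover f x proj₁ (proj₁ (regular′ x))) (L.⋁-lub _ _ λ e →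
        L.≤-trans (f.h⁻≤⁻[] L′.≤-refl)
          (L.≤-trans (k.embedding⇒≤⁻[₊[]] embedding) (k.⁻[]-mono (kL.⋁-ub _ e))))

    module _ (g : Cont kL L′) (g∘k≡f : g ∘ k ≡c f) where
      private
        module g = ContinuousProperties g

      ⁻[g⁻]≤⁻[] : ∀ c → k ⁻[ Cont.f⁻ g c ] L.≤ f ⁻[ L′.β c ]
      ⁻[g⁻]≤⁻[] c = L.≤-trans (proj₁ (g∘k≡f c)) (f.h⁻≤⁻[] L′.≤-refl)

      g⁻≤₊[⁻[]] : ∀ c → Cont.f⁻ g c kL.≤ k ₊[ f ⁻[ L′.β c ] ]
      g⁻≤₊[⁻[]] c = kL.≤-trans k.≤₊[⁻[]] (k.₊[]-mono (⁻[g⁻]≤⁻[] c))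

      ≺⇒₊[⁻[]]≤g⁻ : ∀ {e x} → L′.β e L′.≺ L′.β x → k ₊[ f ⁻[ L′.β e ] ] kL.≤ Cont.f⁻ g x
      ≺⇒₊[⁻[]]≤g⁻ {e} {x} e≺x =
        kL.cover-least (g.⊤-cover _ (L′.annihilator-cover proj₁ (L′.≺-monoʳ e≺x (proj₁ (L′.basis _))))) piece
        where
        piece : ∀ j → k ₊[ f ⁻[ L′.β e ] ] kL.∧ Cont.f⁻ g ([ proj₁ , proj₁ ]′ j) kL.≤ Cont.f⁻ g x
        piece (inj₁ b) = kL.≤-trans (kL.∧-lb₂ _ _) (g.h⁻-mono (proj₂ b))
        piece (inj₂ c) = kL.≤-trans (k.dense⇒𝟘 dense (L.≤-trans
          (L.∧-glb (k.⁻[]-mono (kL.∧-lb₁ _ _)) (k.⁻[]-mono (kL.∧-lb₂ _ _)))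
          (L.≤-trans (L.∧-mono k.⁻[₊[]]≤ (⁻[g⁻]≤⁻[] (proj₁ c)))
            (L.≤-trans f.⁻[]-∧ (f.⁻[]-annihilator c))))) kL.𝟘-least

      ext-unique : g ≡c ext
      ext-unique x =
        kL.≤-trans (Cont.cover g x proj₁ (proj₁ (regular′ x)))
          (kL.⋁-mono _ _ λ e → e , g⁻≤₊[⁻[]] (proj₁ e))
        , kL.⋁-lub _ _ λ e → ≺⇒₊[⁻[]]≤g⁻ (proj₂ e)

    extends-uniquely : UniqueFactor k f
    extends-uniquely = ext , ext∘k≡f , ext-unique

  ⋁ᶜ : ∀ {n} → (Fin n → PCode k) → PCode k
  ⋁ᶜ {zero} p = bot
  ⋁ᶜ {suc n} p = join (p zero) (⋁ᶜ (λ j → p (suc j)))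

  ⟦⋁ᶜ⟧ : ∀ {n} (p : Fin n → PCode k) → ⟦ ⋁ᶜ p ⟧ₖ ≡ L.⋁ᶠ (λ j → ⟦ p j ⟧ₖ)
  ⟦⋁ᶜ⟧ {zero} p = refl
  ⟦⋁ᶜ⟧ {suc n} p = cong (⟦ p zero ⟧ₖ L.∨_) (⟦⋁ᶜ⟧ (λ j → p (suc j)))

  ⊲-⋁ᶜ : ∀ {n} (p q : Fin n → PCode k) → (∀ j → p j ⊲ₖ q j) → ⋁ᶜ p ⊲ₖ ⋁ᶜ q
  ⊲-⋁ᶜ {zero} p q p⊲q = c1₀
  ⊲-⋁ᶜ {suc n} p q p⊲q = c4
    (c2 L.≤-refl (p⊲q zero) L.x≤x∨y)
    (c2 L.≤-refl (⊲-⋁ᶜ (λ j → p (suc j)) (λ j → q (suc j)) (λ j → p⊲q (suc j))) L.y≤x∨y)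

  k∈C : InC k kL k
  k∈C = compact , regular , interpolate
    where
    interpolate : ∀ x y → y kL.≺ x → Σ (PCode k) λ p → Σ (PCode k) λ p′ →
                  (k ⁻[ y ] L.≤ ⟦ p ⟧ₖ) × (p ⊲ₖ p′) × (⟦ p′ ⟧ₖ L.≤ k ⁻[ x ])
    interpolate x y y≺x = ⋁ᶜ (inner ∘′ s) , ⋁ᶜ (outer ∘′ s) , ⁻[y]≤⟦⋁ᶜinner⟧
                          , ⊲-⋁ᶜ _ _ (λ j → inner⊲outer (s j)) , ⟦⋁ᶜouter⟧≤⁻[x]
      where
      open L.≤-Reasoning
      Chain : Set ℓ
      Chain = Σ (Σ kL.B λ b → kL.β b kL.≤ x) λ b → kL.WellInside (proj₁ b)
      chain : Chain → kL.B
      chain (_ , b′) = proj₁ b′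
      x≤⋁chain : x kL.≤ kL.⋁ (λ c → kL.β (chain c))
      x≤⋁chain = kL.≤-trans (proj₁ (kL.basis x)) (kL.⋁-lub _ _ λ b →
        kL.≤-trans (proj₁ (regular (proj₁ b))) (kL.⋁-mono _ _ λ b′ → (b , b′) , kL.≤-refl))
      split = k.⁻[]-finite-split compact chain (kL.≺-monoʳ y≺x x≤⋁chain)
      s = proj₁ (proj₂ split)
      ⁻[y]≤⋁ᶠ = proj₂ (proj₂ split)
      inner outer : Chain ⊎ kL.Annihilator y → PCode k
      inner (inj₁ (_ , b′)) = gen (proj₁ b′)
      inner (inj₂ _) = bot
      outer (inj₁ (b , _)) = gen (proj₁ b)
      outer (inj₂ _) = bot
      inner⊲outer : ∀ j → inner j ⊲ₖ outer j
      inner⊲outer (inj₁ ((b , _) , (b′ , b′≺b))) = gen⊲ b b′ b′≺b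
      inner⊲outer (inj₂ _) = c1₀
      ⁻[y∧]≤inner : ∀ j → k ⁻[ y kL.∧ kL.β ([ chain , proj₁ ]′ j) ] L.≤ ⟦ inner j ⟧ₖ
      ⁻[y∧]≤inner (inj₁ (_ , b′)) = L.≤-trans (k.⁻[]-mono (kL.∧-lb₂ _ _)) (k.⁻[β]≤h⁻ (proj₁ b′))
      ⁻[y∧]≤inner (inj₂ c) = k.⁻[]-annihilator c
      outer≤⁻[x] : ∀ j → ⟦ outer j ⟧ₖ L.≤ k ⁻[ x ]
      outer≤⁻[x] (inj₁ ((_ , b≤x) , _)) = k.h⁻≤⁻[] b≤x
      outer≤⁻[x] (inj₂ _) = L.𝟘-least
      ⁻[y]≤⟦⋁ᶜinner⟧ : k ⁻[ y ] L.≤ ⟦ ⋁ᶜ (inner ∘′ s) ⟧ₖ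
      ⁻[y]≤⟦⋁ᶜinner⟧ = begin
        k ⁻[ y ]                                    ≲⟨ ⁻[y]≤⋁ᶠ ⟩
        L.⋁ᶠ (λ j → k ⁻[ y kL.∧ kL.β ([ chain , proj₁ ]′ (s j)) ])
                                                    ≲⟨ L.⋁ᶠ-least _ (λ j → L.≤-trans (⁻[y∧]≤inner (s j)) (L.⋁ᶠ-ub _ j)) ⟩
        L.⋁ᶠ (λ j → ⟦ inner (s j) ⟧ₖ)              ≡⟨ ⟦⋁ᶜ⟧ (inner ∘′ s) ⟨
        ⟦ ⋁ᶜ (inner ∘′ s) ⟧ₖ                        ∎
      ⟦⋁ᶜouter⟧≤⁻[x] : ⟦ ⋁ᶜ (outer ∘′ s) ⟧ₖ L.≤ k ⁻[ x ]
      ⟦⋁ᶜouter⟧≤⁻[x] = begin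
        ⟦ ⋁ᶜ (outer ∘′ s) ⟧ₖ            ≡⟨ ⟦⋁ᶜ⟧ (outer ∘′ s) ⟩
        L.⋁ᶠ (λ j → ⟦ outer (s j) ⟧ₖ)  ≲⟨ L.⋁ᶠ-least _ (λ j → outer≤⁻[x] (s j)) ⟩
        k ⁻[ x ]                        ∎

corollary4p9 : ∀ {a ℓ : Level} (L : Locale a ℓ) → StronglyRegular L →
    (kL : Locale a ℓ) (k : Cont L kL) → IsCompactification k → SubPcdBasis kL →
    (∀ (L' : Locale a ℓ) (f : Cont L L') → InC k L' f → UniqueFactor k f) ×
    (∀ (k'L : Locale a ℓ) (k' : Cont L k'L) → IsCompactification k' →
       (∀ (L' : Locale a ℓ) (f : Cont L L') → InC k L' f → UniqueFactor k' f) →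
       Σ (Cont k'L kL) (λ h → h ∘ k' ≡c k))
corollary4p9 _ _ kL k isCompactification _ =
  (λ _ f f∈C → Extension.extends-uniquely f f∈C) ,
  (λ _ _ _ factors → let (h , h∘k′≡k , _) = factors kL k k∈C in h , h∘k′≡k)
  where open Compactification k isCompactification
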